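{- Let $D$ be a multi-digraph and let $\mathbf w$ be a closed trail of $D$ with cycle sequence $\mathrm{cs}(\mathbf w)=(\beta_1,\dots,\beta_m)$. Then for each $i=1,\dots,m-1$ the cycle $\beta_i$ shares a vertex with at least one $\beta_j$ with $i<j\le m$. In particular, $\beta_{m-1}$ and $\beta_m$ share a vertex.
   Context: A multi-digraph $D$ has finite vertex set, finite arc set and $\psi:E(D)\to V(D)\times V(D)$ with distinct coordinates (no loops; parallel arcs allowed). A closed trail is a sequence $(v_0,e_1,v_1,\dots,e_d,v_d)$ with $v_d=v_0$, $\psi(e_i)=(v_{i-1},v_i)$, and distinct $e_i$. A cycle is an equivalence class, under cyclic rotation, of closed trails of positive length with no repeated vertex other than $v_0=v_d$; it has a vertex set. Cycle sequence $\mathrm{cs}$: for a length-$0$ trail it is the empty sequence. For $\mathbf w=(v_0,e_1,\dots,e_d,v_d)$ with $d\ge1$, let $t$ be the smallest index such that $v_t=v_s$ for some $s<t$ ($s$ is unique); the subtrail $(v_s,e_{s+1},\dots,e_t,v_t)$ determines a cycle $\beta_1$; deleting it yields the closed trail $\mathbf w'=(v_0,e_1,\dots,e_s,v_s,e_{t+1},\dots,e_d,v_d)$, and $\mathrm{cs}(\mathbf w)=(\beta_1,\mathrm{cs}(\mathbf w'))$. -}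

module Defs where

open import Data.Nat using (ℕ; zero; suc)
open import Data.Fin using (Fin; _≟_)
open import Data.Product using (_×_; _,_; proj₁; proj₂; ∃)
open import Data.List using (List; []; _∷_; _++_; _∷ʳ_; map; length)
open import Data.List.Membership.Propositional using (_∈_)
open import Data.List.Relation.Unary.Unique.Propositional using (Unique)
open import Data.Maybe using (Maybe; just; nothing)
open import Relation.Nullary using (yes; no; ¬_)
open import Relation.Binary.PropositionalEquality using (_≡_)

record MultiDigraph : Set where
  field
    nV     : ℕ
    nE     : ℕ
    ψ      : Fin nE → Fin nV × Fin nV
    noLoop : (e : Fin nE) → ¬ (proj₁ (ψ e) ≡ proj₂ (ψ e))

open MultiDigraph public

Vtx : MultiDigraph → Set
Vtx D = Fin (nV D)

Arc : MultiDigraph → Set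
Arc D = Fin (nE D)

-- A trail (v₀, e₁, v₁, …, e_d, v_d) is represented by its start vertex v₀
-- and the list of steps ((e₁ , v₁) ∷ … ∷ (e_d , v_d) ∷ []).
Steps : MultiDigraph → Set
Steps D = List (Arc D × Vtx D)

data WalkFrom (D : MultiDigraph) : Vtx D → Steps D → Vtx D → Set where
  done : ∀ {u} → WalkFrom D u [] u
  step : ∀ {u e v ss w} → ψ D e ≡ (u , v) → WalkFrom D v ss w →
         WalkFrom D u ((e , v) ∷ ss) w

IsClosedTrail : (D : MultiDigraph) → Vtx D → Steps D → Set
IsClosedTrail D v₀ ss = WalkFrom D v₀ ss v₀ × Unique (map proj₁ ss)

-- A cycle is represented by one of its closed-trail representatives
-- (start vertex, steps); its vertex set is rotation invariant.
CycleRep : MultiDigraph → Set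
CycleRep D = Vtx D × Steps D

-- vertex set of a closed trail (v₀, ss): v₀ equals the last vertex, so the
-- vertices v₁,…,v_d suffice (for positive length).
cycVerts : (D : MultiDigraph) → CycleRep D → List (Vtx D)
cycVerts D (v , ss) = v ∷ map proj₂ ss

SharesVertex : (D : MultiDigraph) → CycleRep D → CycleRep D → Set
SharesVertex D β γ = ∃ λ (u : Vtx D) → (u ∈ cycVerts D β) × (u ∈ cycVerts D γ)

findSplit : (D : MultiDigraph) → Vtx D → Steps D → Maybe (Steps D × Steps D)
findSplit D u [] = nothing
findSplit D u ((e , v) ∷ ps) with v ≟ u
... | yes _ = just ((e , v) ∷ [] , ps)
... | no _ with findSplit D u ps
...   | nothing = nothing
...   | just (A , B) = just ((e , v) ∷ A , B)

-- scan D v₀ pre rest: pre ++ rest are the steps, pre already scanned (no repeated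
-- vertex among v₀ and the vertices of pre).  Finds the smallest t with
-- v_t = v_s, s < t, and returns (A , B , C) with steps = A ++ B ++ C,
-- A = steps 1..s, B = steps s+1..t, C = steps t+1..d.
scan : (D : MultiDigraph) → Vtx D → Steps D → Steps D →
       Maybe (Steps D × Steps D × Steps D)
scan D v₀ pre [] = nothing
scan D v₀ pre ((e , v) ∷ rest) with v ≟ v₀
... | yes _ = just ([] , pre ∷ʳ (e , v) , rest)
... | no _ with findSplit D v pre
...   | just (A , B) = just (A , B ∷ʳ (e , v) , rest)
...   | nothing = scan D v₀ (pre ∷ʳ (e , v)) rest

lastVtx : (D : MultiDigraph) → Vtx D → Steps D → Vtx D
lastVtx D v₀ [] = v₀
lastVtx D v₀ ((_ , v) ∷ ss) = lastVtx D v ss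

-- cycle sequence with fuel (fuel = length suffices, as each step removes ≥1 arc)
csFuel : (D : MultiDigraph) → ℕ → Vtx D → Steps D → List (CycleRep D)
csFuel D zero v₀ ss = []
csFuel D (suc n) v₀ ss with scan D v₀ [] ss
... | nothing = []
... | just (A , B , C) = (lastVtx D v₀ A , B) ∷ csFuel D n v₀ (A ++ C)

cs : (D : MultiDigraph) → Vtx D → Steps D → List (CycleRep D)
cs D v₀ ss = csFuel D (length ss) v₀ ss

-- Cutting the first cycle β₁ out of w at the repeated vertex v leaves a
-- shorter closed trail w' through v whose cycle sequence is (β₂,…,βₘ).  Every
-- vertex of a closed trail lies on some cycle of its cycle sequence, so β₁
-- meets one of β₂,…,βₘ; induction along the sequence gives the claim.
module Submission where

open import Defs
open import Data.Nat using (ℕ; zero; suc; _<_; _≤_; z≤n; s≤s)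
open import Data.Nat.Properties using (≤-refl; <-≤-trans; m<1+n⇒m≤n; +-monoʳ-<; m<n+m)
open import Data.Fin using (Fin; toℕ; _≟_)
open import Data.Product using (_×_; _,_; Σ; proj₂)
open import Data.Sum using (_⊎_; inj₁; inj₂)
open import Data.Maybe using (just; nothing)
open import Data.List using (List; []; _∷_; _++_; _∷ʳ_; [_]; length; lookup; map)
open import Data.List.Properties using (++-assoc; map-++; length-++; length-++-sucʳ)
open import Data.List.Relation.Unary.Any as Any using (Any; here; there)
open import Data.List.Relation.Unary.Any.Properties using (lookup-index)
open import Data.List.Membership.Propositional using (_∈_)
open import Data.List.Membership.Propositional.Properties using (∈-++⁺ˡ; ∈-++⁺ʳ; ∈-++⁻)
open import Relation.Nullary using (yes; no)
open import Relation.Binary.PropositionalEquality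
  using (_≡_; _≢_; refl; sym; trans; cong; subst; module ≡-Reasoning)

∈-++-middle : ∀ {A : Set} {x : A} (xs ys zs : List A) →
              x ∈ xs ++ ys ++ zs → x ∈ xs ++ zs ⊎ x ∈ ys
∈-++-middle xs ys zs x∈ with ∈-++⁻ xs x∈
... | inj₁ x∈xs = inj₁ (∈-++⁺ˡ x∈xs)
... | inj₂ x∈ys++zs with ∈-++⁻ ys x∈ys++zs
...   | inj₁ x∈ys = inj₂ x∈ys
...   | inj₂ x∈zs = inj₁ (∈-++⁺ʳ xs x∈zs)

length-++-middle-< : ∀ {A : Set} (xs ys zs : List A) → 0 < length ys →
                     length (xs ++ zs) < length (xs ++ ys ++ zs)
length-++-middle-< xs ys zs 0<ys
  rewrite length-++ xs {zs} | length-++ xs {ys ++ zs} | length-++ ys {zs}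
  = +-monoʳ-< (length xs) (m<n+m (length zs) 0<ys)

length-∷ʳ-positive : ∀ {A : Set} (xs : List A) (x : A) → 0 < length (xs ∷ʳ x)
length-∷ʳ-positive xs x = subst (0 <_) (sym (length-++-sucʳ xs x [])) (s≤s z≤n)

module _ (D : MultiDigraph) where

  Closed : Vtx D → Steps D → Set
  Closed v ss = lastVtx D v ss ≡ v

  vertices : Steps D → List (Vtx D)
  vertices = map proj₂

  walk-lastVtx : ∀ {u ss w} → WalkFrom D u ss w → lastVtx D u ss ≡ w
  walk-lastVtx done       = refl
  walk-lastVtx (step _ r) = walk-lastVtx r

  lastVtx-∷ʳ : ∀ v (ss : Steps D) s → lastVtx D v (ss ∷ʳ s) ≡ proj₂ s
  lastVtx-∷ʳ v []       s = refl
  lastVtx-∷ʳ v (t ∷ ss) s = lastVtx-∷ʳ (proj₂ t) ss s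

  lastVtx-++ : ∀ v (ss ts : Steps D) → lastVtx D v (ss ++ ts) ≡ lastVtx D (lastVtx D v ss) ts
  lastVtx-++ v []       ts = refl
  lastVtx-++ v (s ∷ ss) ts = lastVtx-++ (proj₂ s) ss ts

  lastVtx-∈ : ∀ v s (ss : Steps D) → lastVtx D v (s ∷ ss) ∈ vertices (s ∷ ss)
  lastVtx-∈ v s []       = here refl
  lastVtx-∈ v s (t ∷ ss) = there (lastVtx-∈ (proj₂ s) t ss)

  closed-excise : ∀ v (A B C : Steps D) → Closed (lastVtx D v A) B →
                  Closed v (A ++ B ++ C) → Closed v (A ++ C)
  closed-excise v A B C closedB closed = begin
    lastVtx D v (A ++ C)                        ≡⟨ lastVtx-++ v A C ⟩
    lastVtx D (lastVtx D v A) C                 ≡⟨ cong (λ u → lastVtx D u C) (sym closedB) ⟩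
    lastVtx D (lastVtx D (lastVtx D v A) B) C   ≡⟨ sym (lastVtx-++ (lastVtx D v A) B C) ⟩
    lastVtx D (lastVtx D v A) (B ++ C)          ≡⟨ sym (lastVtx-++ v A (B ++ C)) ⟩
    lastVtx D v (A ++ B ++ C)                   ≡⟨ closed ⟩
    v                                           ∎
    where open ≡-Reasoning

  excision-vertex-∈ : ∀ v (A C : Steps D) → Closed v (A ++ C) →
                      A ++ C ≡ [] ⊎ lastVtx D v A ∈ vertices (A ++ C)
  excision-vertex-∈ v []      []      _      = inj₁ refl
  excision-vertex-∈ v []      (c ∷ C) closed = inj₂ (subst (_∈ vertices (c ∷ C)) closed (lastVtx-∈ v c C))
  excision-vertex-∈ v (a ∷ A) C       _      =
    inj₂ (subst (lastVtx D v (a ∷ A) ∈_) (sym (map-++ proj₂ (a ∷ A) C)) (∈-++⁺ˡ (lastVtx-∈ v a A)))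

  findSplit-spec : ∀ u (ps : Steps D) {A B} → findSplit D u ps ≡ just (A , B) →
                   ps ≡ A ++ B × (∀ v → lastVtx D v A ≡ u)
  findSplit-spec u ((e , v) ∷ ps) eq with v ≟ u
  findSplit-spec u ((e , v) ∷ ps) refl | yes v≡u = refl , λ _ → v≡u
  ... | no _ with findSplit D u ps in eq′
  findSplit-spec u ((e , v) ∷ ps) refl | no _ | just _ with findSplit-spec u ps eq′
  ... | ps≡ , lastA = cong ((e , v) ∷_) ps≡ , λ _ → lastA v

  scan-spec : ∀ v₀ (pre rest : Steps D) {A B C} → scan D v₀ pre rest ≡ just (A , B , C) →
              pre ++ rest ≡ A ++ B ++ C × 0 < length B × Closed (lastVtx D v₀ A) B
  scan-spec v₀ pre ((e , v) ∷ rest) eq with v ≟ v₀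
  scan-spec v₀ pre ((e , v) ∷ rest) refl | yes v≡v₀ =
    sym (++-assoc pre [ e , v ] rest) ,
    length-∷ʳ-positive pre (e , v) ,
    trans (lastVtx-∷ʳ v₀ pre (e , v)) v≡v₀
  ... | no _ with findSplit D v pre in eq′
  scan-spec v₀ pre ((e , v) ∷ rest) refl | no _ | just (A , B) with findSplit-spec v pre eq′
  ... | refl , lastA =
    trans (++-assoc A B ((e , v) ∷ rest)) (cong (A ++_) (sym (++-assoc B [ e , v ] rest))) ,
    length-∷ʳ-positive B (e , v) ,
    trans (lastVtx-∷ʳ _ B (e , v)) (sym (lastA v₀))
  scan-spec v₀ pre ((e , v) ∷ rest) eq | no _ | nothing =
    let pre++rest≡ , cycle-facts = scan-spec v₀ (pre ∷ʳ (e , v)) rest eq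
    in trans (sym (++-assoc pre [ e , v ] rest)) pre++rest≡ , cycle-facts

  -- At the latest, the return to v₀ at the end of the trail is detected.
  scan-closed : ∀ v₀ (pre : Steps D) s rest → Closed v₀ (s ∷ rest) →
                scan D v₀ pre (s ∷ rest) ≢ nothing
  scan-closed v₀ pre (e , v) rest closed eq with v ≟ v₀
  scan-closed v₀ pre (e , v) rest closed () | yes _
  ... | no _ with findSplit D v pre
  scan-closed v₀ pre (e , v) rest closed () | no _ | just _
  scan-closed v₀ pre (e , v) []       closed eq | no v≢v₀ | nothing = v≢v₀ closed
  scan-closed v₀ pre (e , v) (s ∷ rest) closed eq | no _ | nothing =
    scan-closed v₀ (pre ∷ʳ (e , v)) s rest closed eq

  data CsStep (n : ℕ) (v₀ : Vtx D) : Steps D → Set where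
    no-cycle : CsStep n v₀ []
    excise   : ∀ A B C →
               length (A ++ C) < length (A ++ B ++ C) → Closed v₀ (A ++ C) →
               csFuel D (suc n) v₀ (A ++ B ++ C) ≡ (lastVtx D v₀ A , B) ∷ csFuel D n v₀ (A ++ C) →
               CsStep n v₀ (A ++ B ++ C)

  csFuel-suc-scan : ∀ n v₀ ss {A B C} → scan D v₀ [] ss ≡ just (A , B , C) →
                    csFuel D (suc n) v₀ ss ≡ (lastVtx D v₀ A , B) ∷ csFuel D n v₀ (A ++ C)
  csFuel-suc-scan n v₀ ss eq rewrite eq = refl

  csStep : ∀ n v₀ ss → Closed v₀ ss → CsStep n v₀ ss
  csStep n v₀ ss closed with scan D v₀ [] ss in eq
  csStep n v₀ []      closed | nothing = no-cycle
  csStep n v₀ (s ∷ ss) closed | nothing with () ← scan-closed v₀ [] s ss closed eq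
  ... | just (A , B , C) with scan-spec v₀ [] ss eq | csFuel-suc-scan n v₀ ss eq
  ... | refl , 0<B , closedB | unfold =
    excise A B C (length-++-middle-< A B C 0<B) (closed-excise v₀ A B C closedB closed) unfold

  csFuel-[] : ∀ n v₀ → csFuel D n v₀ [] ≡ []
  csFuel-[] zero    v₀ = refl
  csFuel-[] (suc n) v₀ = refl

  csFuel-covers : ∀ n v₀ ss → length ss ≤ n → Closed v₀ ss →
                  ∀ {u} → u ∈ vertices ss → Any (λ β → u ∈ cycVerts D β) (csFuel D n v₀ ss)
  csFuel-covers zero    v₀ (s ∷ ss) () closed u∈
  csFuel-covers (suc n) v₀ ss len closed u∈ with csStep n v₀ ss closed
  csFuel-covers (suc n) v₀ .(A ++ B ++ C) len _ u∈ | excise A B C shorter closed′ unfold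
    rewrite unfold | map-++ proj₂ A (B ++ C) | map-++ proj₂ B C
    with ∈-++-middle (vertices A) (vertices B) (vertices C) u∈
  ... | inj₂ u∈B  = here (there u∈B)
  ... | inj₁ u∈AC = there (csFuel-covers n v₀ (A ++ C) (m<1+n⇒m≤n (<-≤-trans shorter len)) closed′
                            (subst (_ ∈_) (sym (map-++ proj₂ A C)) u∈AC))

  data MeetsLater : List (CycleRep D) → Set where
    []  : MeetsLater []
    single : ∀ β → MeetsLater [ β ]
    _∷_ : ∀ {β γs} → Any (SharesVertex D β) γs → MeetsLater γs → MeetsLater (β ∷ γs)

  csFuel-meetsLater : ∀ n v₀ ss → length ss ≤ n → Closed v₀ ss → MeetsLater (csFuel D n v₀ ss)
  csFuel-meetsLater zero    v₀ ss len closed = []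
  csFuel-meetsLater (suc n) v₀ ss len closed with csStep n v₀ ss closed
  ... | no-cycle = []
  csFuel-meetsLater (suc n) v₀ .(A ++ B ++ C) len _ | excise A B C shorter closed′ unfold
    rewrite unfold
    with excision-vertex-∈ v₀ A C closed′ | csFuel-meetsLater n v₀ (A ++ C) (m<1+n⇒m≤n (<-≤-trans shorter len)) closed′
  ... | inj₁ AC≡[] | _ rewrite AC≡[] | csFuel-[] n v₀ = single _
  ... | inj₂ v∈AC  | rest =
    Any.map (λ v∈γ → _ , here refl , v∈γ)
            (csFuel-covers n v₀ (A ++ C) (m<1+n⇒m≤n (<-≤-trans shorter len)) closed′ v∈AC)
    ∷ rest

  meetsLater-lookup : ∀ {βs} → MeetsLater βs → (i : Fin (length βs)) → suc (toℕ i) < length βs →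
                      Σ (Fin (length βs)) λ j → toℕ i < toℕ j × SharesVertex D (lookup βs i) (lookup βs j)
  meetsLater-lookup (single _) Fin.zero (s≤s ())
  meetsLater-lookup (p ∷ _) Fin.zero _ = Fin.suc (Any.index p) , s≤s z≤n , lookup-index p
  meetsLater-lookup (_ ∷ m) (Fin.suc i) (s≤s i<) with meetsLater-lookup m i i<
  ... | j , i<j , shares = Fin.suc j , s≤s i<j , shares

  meetsLater-last : ∀ βs {β γ} → MeetsLater (βs ++ β ∷ γ ∷ []) → SharesVertex D β γ
  meetsLater-last []            (here shares ∷ _) = shares
  meetsLater-last (_ ∷ [])      (_ ∷ m)           = meetsLater-last [] m
  meetsLater-last (_ ∷ β′ ∷ βs) (_ ∷ m)           = meetsLater-last (β′ ∷ βs) m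

mainTheorem16 : (D : MultiDigraph) (v₀ : Vtx D) (ss : Steps D) →
    IsClosedTrail D v₀ ss →
    ((i : Fin (length (cs D v₀ ss))) → suc (toℕ i) < length (cs D v₀ ss) →
      Σ (Fin (length (cs D v₀ ss))) λ j →
        (toℕ i < toℕ j) × SharesVertex D (lookup (cs D v₀ ss) i) (lookup (cs D v₀ ss) j))
    × ((xs : List (CycleRep D)) (β γ : CycleRep D) →
        cs D v₀ ss ≡ xs ++ (β ∷ γ ∷ []) → SharesVertex D β γ)
mainTheorem16 D v₀ ss (walk , _) =
  meetsLater-lookup D meets ,
  λ βs β γ cs≡ → meetsLater-last D βs (subst (MeetsLater D) cs≡ meets)
  where
  meets : MeetsLater D (cs D v₀ ss)
  meets = csFuel-meetsLater D (length ss) v₀ ss ≤-refl (walk-lastVtx D walk)
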